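{- The predicate $\mathrm{tr}_{\mathscr{A}}\in\mathsf{P}\mathscr{A}$ is a generic predicate for $\mathsf{P}$: for every set $X$, the map $\mathscr{A}^X\to\mathsf{P}X$, $a\mapsto\mathsf{P}a(\mathrm{tr}_{\mathscr{A}})$, is surjective.
   Context: $\mathsf{P}:\mathbf{Set}^{\mathrm{op}}\to\mathbf{HA}$ is a $\mathbf{Set}$-based tripos: a functor into Heyting algebras such that (1) each $\mathsf{P}f:\mathsf{P}Y\to\mathsf{P}X$ ($f:X\to Y$) has a left adjoint $\exists f$ and right adjoint $\forall f$ among monotone maps $\mathsf{P}X\to\mathsf{P}Y$; (2) for every pullback square in $\mathbf{Set}$ with $f_1:X\to X_1,f_2:X\to X_2,g_1:X_1\to Y,g_2:X_2\to Y$, $\exists f_1\circ\mathsf{P}f_2=\mathsf{P}g_1\circ\exists g_2$ and $\forall f_1\circ\mathsf{P}f_2=\mathsf{P}g_1\circ\forall g_2$; (3) there is a set $\Sigma$ and $\mathrm{tr}_\Sigma\in\mathsf{P}\Sigma$ with $\sigma\mapsto\mathsf{P}\sigma(\mathrm{tr}_\Sigma)$, $\Sigma^X\to\mathsf{P}X$, surjective for every set $X$. Fix these; for $\sigma\in\Sigma^X$ write $[\![\sigma]\!]_X:=\mathsf{P}\sigma(\mathrm{tr}_\Sigma)$. Let $\pi,\pi'$ be the projections $\Sigma\times\Sigma\to\Sigma$ and $\dot\to:\Sigma\times\Sigma\to\Sigma$ (infix) any map with $[\![\dot\to]\!]_{\Sigma\times\Sigma}=[\![\pi]\!]_{\Sigma\times\Sigma}\to[\![\pi']\!]_{\Sigma\times\Sigma}$.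 Let $E=\{(\xi,s)\in\Sigma\times\mathfrak{P}(\Sigma):\xi\in s\}$ with projections $e_1,e_2$, and $\dot\bigwedge:\mathfrak{P}(\Sigma)\to\Sigma$ any map with $[\![\dot\bigwedge]\!]_{\mathfrak{P}(\Sigma)}=\forall e_2([\![e_1]\!]_E)$. Let $\mathscr{A}_0$ be the set of atoms inductively generated by: an atom $\dot\xi$ for each $\xi\in\Sigma$, and an atom $(s\mapsto\alpha)$ for each $s\subseteq\Sigma$, $\alpha\in\mathscr{A}_0$. The preorder $\le$ on $\mathscr{A}_0$ is inductively generated by $\dot\xi\le\dot\xi$ and: $s\subseteq s'$, $\alpha\le\alpha'$ imply $(s\mapsto\alpha)\le(s'\mapsto\alpha')$. Define $\phi_0:\mathscr{A}_0\to\Sigma$ by $\phi_0(\dot\xi)=\xi$, $\phi_0(s\mapsto\alpha)=(\dot\bigwedge s)\mathbin{\dot\to}\phi_0(\alpha)$. Let $\mathscr{A}$ be the set of upward closed subsets of $(\mathscr{A}_0,\le)$. Define $\phi:\mathscr{A}\to\Sigma$ by $\phi(a)=\dot\bigwedge\{\phi_0(\alpha):\alpha\in a\}$, and $\mathrm{tr}_{\mathscr{A}}:=\mathsf{P}\phi(\mathrm{tr}_\Sigma)\in\mathsf{P}\mathscr{A}$. The axiom of choice is assumed. -}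

module Defs where

open import Level using (Level; _⊔_; suc; zero; Setω)
open import Function using (id; _∘_)
open import Data.Product using (Σ; ∃; _×_; _,_; proj₁; proj₂)
open import Relation.Binary.PropositionalEquality using (_≡_)
open import Relation.Binary.Lattice.Bundles using (HeytingAlgebra)

record IsPullback {a b c d} {X : Set a} {X₁ : Set b} {X₂ : Set c} {Y : Set d}
                  (f₁ : X → X₁) (f₂ : X → X₂) (g₁ : X₁ → Y) (g₂ : X₂ → Y)
                  : Set (a ⊔ b ⊔ c ⊔ d) where
  field
    commutes  : ∀ x → g₁ (f₁ x) ≡ g₂ (f₂ x)
    universal : ∀ x₁ x₂ → g₁ x₁ ≡ g₂ x₂ → Σ X (λ x → f₁ x ≡ x₁ × f₂ x ≡ x₂)
    unique    : ∀ x x′ → f₁ x ≡ f₁ x′ → f₂ x ≡ f₂ x′ → x ≡ x′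

module _ {c₁ e₁ l₁ c₂ e₂ l₂} (H : HeytingAlgebra c₁ e₁ l₁) (K : HeytingAlgebra c₂ e₂ l₂) where
  private
    module H = HeytingAlgebra H
    module K = HeytingAlgebra K

  record IsHAHom (h : H.Carrier → K.Carrier) : Set (c₁ ⊔ e₁ ⊔ e₂) where
    field
      cong   : ∀ {p q} → p H.≈ q → h p K.≈ h q
      pres-⊤ : h H.⊤ K.≈ K.⊤
      pres-⊥ : h H.⊥ K.≈ K.⊥
      pres-∧ : ∀ p q → h (p H.∧ q) K.≈ (h p K.∧ h q)
      pres-∨ : ∀ p q → h (p H.∨ q) K.≈ (h p K.∨ h q)
      pres-⇨ : ∀ p q → h (p H.⇨ q) K.≈ (h p K.⇨ h q)

-- Set-based triposes.  "Set" = Agda types of all universe levels; the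
-- Heyting algebra P X for X : Set a has carrier/equality/order levels
-- c a, e a, l a.  The set Σ of condition (3) lives in Set s.

module _ {c e l : Level → Level} (P : ∀ {a} → Set a → HeytingAlgebra (c a) (e a) (l a)) where

  Pred : ∀ {a} → Set a → Set (c a)
  Pred X = HeytingAlgebra.Carrier (P X)

  _≈ₚ_ : ∀ {a} {X : Set a} → Pred X → Pred X → Set (e a)
  _≈ₚ_ {X = X} = HeytingAlgebra._≈_ (P X)

  _≤ₚ_ : ∀ {a} {X : Set a} → Pred X → Pred X → Set (l a)
  _≤ₚ_ {X = X} = HeytingAlgebra._≤_ (P X)

  _⇨ₚ_ : ∀ {a} {X : Set a} → Pred X → Pred X → Pred X
  _⇨ₚ_ {X = X} = HeytingAlgebra._⇨_ (P X)

  record IsTripos (s : Level) : Setω where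
    field
      map     : ∀ {a b} {X : Set a} {Y : Set b} → (X → Y) → Pred Y → Pred X
      map-hom : ∀ {a b} {X : Set a} {Y : Set b} (f : X → Y) → IsHAHom (P Y) (P X) (map f)
      map-id  : ∀ {a} {X : Set a} (p : Pred X) → map id p ≈ₚ p
      map-∘   : ∀ {a b d} {X : Set a} {Y : Set b} {Z : Set d} (f : X → Y) (g : Y → Z)
                  (p : Pred Z) → map (g ∘ f) p ≈ₚ map f (map g p)
      ∃ᶠ      : ∀ {a b} {X : Set a} {Y : Set b} → (X → Y) → Pred X → Pred Y
      ∀ᶠ      : ∀ {a b} {X : Set a} {Y : Set b} → (X → Y) → Pred X → Pred Y
      ∃-mono  : ∀ {a b} {X : Set a} {Y : Set b} (f : X → Y) {p q : Pred X} →
                  p ≤ₚ q → ∃ᶠ f p ≤ₚ ∃ᶠ f q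
      ∀-mono  : ∀ {a b} {X : Set a} {Y : Set b} (f : X → Y) {p q : Pred X} →
                  p ≤ₚ q → ∀ᶠ f p ≤ₚ ∀ᶠ f q
      ∃⊣map   : ∀ {a b} {X : Set a} {Y : Set b} (f : X → Y) (p : Pred X) (q : Pred Y) →
                  (∃ᶠ f p ≤ₚ q → p ≤ₚ map f q) × (p ≤ₚ map f q → ∃ᶠ f p ≤ₚ q)
      map⊣∀   : ∀ {a b} {X : Set a} {Y : Set b} (f : X → Y) (q : Pred Y) (p : Pred X) →
                  (map f q ≤ₚ p → q ≤ₚ ∀ᶠ f p) × (q ≤ₚ ∀ᶠ f p → map f q ≤ₚ p)
      BC-∃    : ∀ {a b d k} {X : Set a} {X₁ : Set b} {X₂ : Set d} {Y : Set k}
                  (f₁ : X → X₁) (f₂ : X → X₂) (g₁ : X₁ → Y) (g₂ : X₂ → Y) →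
                  IsPullback f₁ f₂ g₁ g₂ →
                  ∀ (p : Pred X₂) → ∃ᶠ f₁ (map f₂ p) ≈ₚ map g₁ (∃ᶠ g₂ p)
      BC-∀    : ∀ {a b d k} {X : Set a} {X₁ : Set b} {X₂ : Set d} {Y : Set k}
                  (f₁ : X → X₁) (f₂ : X → X₂) (g₁ : X₁ → Y) (g₂ : X₂ → Y) →
                  IsPullback f₁ f₂ g₁ g₂ →
                  ∀ (p : Pred X₂) → ∀ᶠ f₁ (map f₂ p) ≈ₚ map g₁ (∀ᶠ g₂ p)
      Sig     : Set s
      trSig   : Pred Sig
      generic : ∀ {a} (X : Set a) (p : Pred X) →
                  Σ (X → Sig) (λ σ → map σ trSig ≈ₚ p)

record Tripos (c e l : Level → Level) (s : Level) : Setω where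
  field
    P        : ∀ {a} → Set a → HeytingAlgebra (c a) (e a) (l a)
    isTripos : IsTripos P s
  open IsTripos isTripos public

module Construction {c e l : Level → Level} {s : Level} (T : Tripos c e l s) where
  open Tripos T

  private
    _≈_ : ∀ {a} {X : Set a} → Pred P X → Pred P X → Set (e a)
    _≈_ = _≈ₚ_ P
    _⇨_ : ∀ {a} {X : Set a} → Pred P X → Pred P X → Pred P X
    _⇨_ = _⇨ₚ_ P

  ⟦_⟧ : ∀ {a} {X : Set a} → (X → Sig) → Pred P X
  ⟦ σ ⟧ = map σ trSig

  Subset : (ℓ : Level) → Set (s ⊔ suc ℓ)
  Subset ℓ = Sig → Set ℓ

  E : (ℓ : Level) → Set (s ⊔ suc ℓ)
  E ℓ = Σ (Sig × Subset ℓ) (λ p → proj₂ p (proj₁ p))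

  e₁ : ∀ {ℓ} → E ℓ → Sig
  e₁ ((ξ , S) , _) = ξ

  e₂ : ∀ {ℓ} → E ℓ → Subset ℓ
  e₂ ((ξ , S) , _) = S

  IsImpCode : (Sig × Sig → Sig) → Set (e s)
  IsImpCode imp = ⟦ imp ⟧ ≈ (⟦ proj₁ ⟧ ⇨ ⟦ proj₂ ⟧)

  IsMeetCode : (ℓ : Level) → (Subset ℓ → Sig) → Set (e (s ⊔ suc ℓ))
  IsMeetCode ℓ mt = ⟦ mt ⟧ ≈ ∀ᶠ e₂ ⟦ e₁ {ℓ} ⟧

  module Atoms (imp : Sig × Sig → Sig)
               (⋀₀ : Subset s → Sig)
               (⋀₁ : Subset (suc s) → Sig) where

    data Atom : Set (suc s) where
      dot  : Sig → Atom
      _↦_ : Subset s → Atom → Atom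

    data _≤A_ : Atom → Atom → Set (suc s) where
      dot≤ : ∀ ξ → dot ξ ≤A dot ξ
      ↦≤  : ∀ {S S′ α α′} → (∀ ξ → S ξ → S′ ξ) → α ≤A α′ → (S ↦ α) ≤A (S′ ↦ α′)

    φ₀ : Atom → Sig
    φ₀ (dot ξ) = ξ
    φ₀ (S ↦ α) = imp (⋀₀ S , φ₀ α)

    record 𝒜 : Set (suc s) where
      field
        mem : Atom → Set s
        up  : ∀ {α β} → α ≤A β → mem α → mem β

    φ : 𝒜 → Sig
    φ a = ⋀₁ (λ ξ → Σ Atom (λ α → 𝒜.mem a α × φ₀ α ≡ ξ))

    tr𝒜 : Pred P 𝒜
    tr𝒜 = map φ trSig

  IsGeneric : ∀ {k} {A : Set k} → Pred P A → Setω
  IsGeneric {A = A} t = ∀ {a} (X : Set a) (p : Pred P X) →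
                          Σ (X → A) (λ f → map f t ≈ p)

module Submission where

open import Defs
open import Level using (Level; suc)
open import Data.Product using (_×_; Σ; _,_; proj₁; proj₂)
open import Function using (id; _∘_)
open import Relation.Binary.PropositionalEquality using (_≡_; refl; cong)
open import Relation.Binary.Lattice.Bundles using (HeytingAlgebra)
import Relation.Binary.Reasoning.Setoid as SetoidReasoning

-- The upward closed set generated by the atom ξ̇ contains no other atom, so its
-- image under φ₀ is the singleton {ξ}. A meet code evaluated on singletons is the
-- identity up to ⟦_⟧ (Beck–Chevalley along the pullback of e₂ : E → 𝔓(Σ) over the
-- singleton map, whose pullback is Σ itself). Hence ξ ↦ ↑ξ̇ is a section of φ up to
-- ⟦_⟧, and every σ : X → Σ lifts to x ↦ ↑(σ x)̇ : X → 𝒜.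

module TriposFacts {c e l : Level → Level} {s : Level} (T : Tripos c e l s) where
  open Tripos T
  open Construction T

  private
    module H {a} (X : Set a) = HeytingAlgebra (P X)

    _≈_ : ∀ {a} {X : Set a} → Pred P X → Pred P X → Set (e a)
    _≈_ = _≈ₚ_ P

  ∀ᶠ-id : ∀ {a} {X : Set a} (q : Pred P X) → ∀ᶠ id q ≈ q
  ∀ᶠ-id {X = X} q = H.antisym X
    (H.trans X (H.reflexive X (H.Eq.sym X (map-id (∀ᶠ id q))))
               (proj₂ (map⊣∀ id (∀ᶠ id q) q) (H.refl X)))
    (proj₁ (map⊣∀ id q q) (H.reflexive X (map-id q)))

  ⟦⋀⟧-singleton : ∀ {ℓ a} {X : Set a} (⋀ : Subset ℓ → Sig) → IsMeetCode ℓ ⋀ →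
                   (σ : X → Sig) (S : X → Subset ℓ) (centre : ∀ x → S x (σ x)) →
                   (∀ x {ξ} (m : S x ξ) → _≡_ {A = Σ Sig (S x)} (σ x , centre x) (ξ , m)) →
                   ⟦ ⋀ ∘ S ⟧ ≈ ⟦ σ ⟧
  ⟦⋀⟧-singleton {ℓ} {X = X} ⋀ isMeet σ S centre contract = begin
    map (⋀ ∘ S) trSig              ≈⟨ map-∘ S ⋀ trSig ⟩
    map S (map ⋀ trSig)            ≈⟨ IsHAHom.cong (map-hom S) isMeet ⟩
    map S (∀ᶠ e₂ ⟦ e₁ ⟧)           ≈⟨ H.Eq.sym X (BC-∀ id point S e₂ pullback ⟦ e₁ ⟧) ⟩
    ∀ᶠ id (map point (map e₁ trSig)) ≈⟨ ∀ᶠ-id _ ⟩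
    map point (map e₁ trSig)       ≈⟨ H.Eq.sym X (map-∘ point e₁ trSig) ⟩
    map σ trSig                    ∎
    where
    open SetoidReasoning (H.setoid X)

    point : X → E ℓ
    point x = (σ x , S x) , centre x

    fibre : ∀ x (y : E ℓ) → S x ≡ e₂ y → Σ X (λ x′ → x′ ≡ x × point x′ ≡ y)
    fibre x ((ξ , ._) , m) refl = x , refl , cong (λ { (ξ′ , m′) → (ξ′ , S x) , m′ }) (contract x m)

    pullback : IsPullback id point S e₂
    pullback = record
      { commutes  = λ _ → refl
      ; universal = fibre
      ; unique    = λ _ _ eq _ → eq
      }

  generic-of-section : ∀ {k} {A : Set k} (φ : A → Sig) (ι : Sig → A) →
                       ⟦ φ ∘ ι ⟧ ≈ ⟦ id ⟧ → IsGeneric (map φ trSig)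
  generic-of-section φ ι section X p = ι ∘ σ , (begin
    map (ι ∘ σ) (map φ trSig)  ≈⟨ H.Eq.sym X (map-∘ (ι ∘ σ) φ trSig) ⟩
    map (φ ∘ ι ∘ σ) trSig      ≈⟨ map-∘ σ (φ ∘ ι) trSig ⟩
    map σ ⟦ φ ∘ ι ⟧            ≈⟨ IsHAHom.cong (map-hom σ) section ⟩
    map σ (map id trSig)       ≈⟨ H.Eq.sym X (map-∘ σ id trSig) ⟩
    map σ trSig                ≈⟨ proj₂ (generic X p) ⟩
    p                          ∎)
    where
    open SetoidReasoning (H.setoid X)
    σ = proj₁ (generic X p)

module PrincipalUpset {c e l : Level → Level} {s : Level} (T : Tripos c e l s)
  (imp : Tripos.Sig T × Tripos.Sig T → Tripos.Sig T)
  (⋀₀ : Construction.Subset T s → Tripos.Sig T)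
  (⋀₁ : Construction.Subset T (suc s) → Tripos.Sig T) where
  open Tripos T
  open Construction T
  open Atoms imp ⋀₀ ⋀₁

  data IsDot (ξ : Sig) : Atom → Set s where
    dot : IsDot ξ (dot ξ)

  ↑dot : Sig → 𝒜
  ↑dot ξ = record { mem = IsDot ξ ; up = λ { (dot≤ _) dot → dot } }

  φ₀-image : 𝒜 → Subset (suc s)
  φ₀-image a ξ = Σ Atom (λ α → 𝒜.mem a α × φ₀ α ≡ ξ)

  φ₀-image-↑dot-∋ : ∀ ξ → φ₀-image (↑dot ξ) ξ
  φ₀-image-↑dot-∋ ξ = dot ξ , dot , refl

  φ₀-image-↑dot-unique : ∀ ξ {ξ′} (m : φ₀-image (↑dot ξ) ξ′) →
                         _≡_ {A = Σ Sig (φ₀-image (↑dot ξ))} (ξ , φ₀-image-↑dot-∋ ξ) (ξ′ , m)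
  φ₀-image-↑dot-unique ξ (.(dot ξ) , dot , refl) = refl

proposition3p6 : ∀ {c e l : Level → Level} {s : Level} (T : Tripos c e l s) →
    let open Tripos T in
    let open Construction T in
    (imp : Sig × Sig → Sig) → IsImpCode imp →
    (⋀₀ : Subset s → Sig) → IsMeetCode s ⋀₀ →
    (⋀₁ : Subset (suc s) → Sig) → IsMeetCode (suc s) ⋀₁ →
    IsGeneric (Atoms.tr𝒜 imp ⋀₀ ⋀₁)
proposition3p6 T imp _ ⋀₀ _ ⋀₁ isMeet₁ =
  generic-of-section φ ↑dot
    (⟦⋀⟧-singleton ⋀₁ isMeet₁ id (φ₀-image ∘ ↑dot) φ₀-image-↑dot-∋ φ₀-image-↑dot-unique)
  where
  open TriposFacts T
  open Construction.Atoms T imp ⋀₀ ⋀₁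
  open PrincipalUpset T imp ⋀₀ ⋀₁
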